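{- For the complete graph $K_n$ on $n\ge0$ vertices, the refined skew characteristic polynomial is $$\overline{Q}_{K_n}(u,v)=\sum_{k=0}^{\lfloor n/2\rfloor}\binom{n}{2k}u^{n-2k}+v\sum_{k=0}^{\lfloor (n-1)/2\rfloor}\binom{n}{2k+1}u^{n-2k-1}.$$
   Context: For a finite simple graph $G$ with vertex set $V(G)$, and $U\subseteq V(G)$, let $G(U)$ be the induced subgraph and $A_{G(U)}$ its adjacency matrix over the field $\mathbb{F}_2$ (the empty matrix, of corank $0$, for $U=\emptyset$). The refined skew characteristic polynomial is $\overline{Q}_G(u,v)=\sum_{U\subseteq V(G)}u^{|V(G)|-|U|}v^{\operatorname{corank}A_{G(U)}}$, where the corank is $|U|$ minus the rank over $\mathbb{F}_2$. -}

module Defs where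

open import Level using (Level)
open import Data.Bool using (Bool; true; false; not; _xor_; _∧_; _∨_)
open import Data.Nat using (ℕ; zero; suc; _∸_; _⊔_)
open import Data.Fin using (Fin; _≟_)
open import Data.List using (List; []; _∷_; map; foldr; length; zipWith; replicate; allFin; filter; upTo)
open import Relation.Nullary.Decidable using (⌊_⌋)
open import Relation.Binary.PropositionalEquality using (_≡_)
open import Algebra.Bundles using (CommutativeSemiring)

record Graph (n : ℕ) : Set where
  field
    adj   : Fin n → Fin n → Bool
    sym   : ∀ i j → adj i j ≡ adj j i
    irrefl : ∀ i → adj i i ≡ false

completeGraph : (n : ℕ) → Graph n
completeGraph n = record
  { adj    = λ i j → not ⌊ i ≟ j ⌋
  ; sym    = symK
  ; irrefl = irreflK }
  where
  open import Relation.Binary.PropositionalEquality using (refl; sym)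
  open import Relation.Nullary using (yes; no)
  symK : ∀ i j → not ⌊ i ≟ j ⌋ ≡ not ⌊ j ≟ i ⌋
  symK i j with i ≟ j | j ≟ i
  ... | yes _ | yes _ = refl
  ... | no _  | no _  = refl
  ... | yes p | no q  = Data.Empty.⊥-elim (q (sym p)) where import Data.Empty
  ... | no p  | yes q = Data.Empty.⊥-elim (p (sym q)) where import Data.Empty
  irreflK : ∀ i → not ⌊ i ≟ i ⌋ ≡ false
  irreflK i with i ≟ i
  ... | yes _ = refl
  ... | no ¬p = Data.Empty.⊥-elim (¬p refl) where import Data.Empty

subsequences : ∀ {a} {A : Set a} → List A → List (List A)
subsequences []       = [] ∷ []
subsequences (x ∷ xs) = subsequences xs Data.List.++ map (x ∷_) (subsequences xs)

-- Linear algebra over F₂ = Bool (addition = xor)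

Row : Set
Row = List Bool

Matrix : Set
Matrix = List Row

_⊕_ : Row → Row → Row
_⊕_ = zipWith _xor_

sumRows : ℕ → List Row → Row
sumRows k = foldr _⊕_ (replicate k false)

isZeroRow : Row → Bool
isZeroRow = foldr (λ b r → not b ∧ r) true

nonEmpty : ∀ {a} {A : Set a} → List A → Bool
nonEmpty []      = false
nonEmpty (_ ∷ _) = true

linIndep : ℕ → List Row → Bool
linIndep k rs = foldr _∧_ true
  (map (λ T → not (nonEmpty T) ∨ not (isZeroRow (sumRows k T))) (subsequences rs))

filterB : ∀ {a} {A : Set a} → (A → Bool) → List A → List A
filterB p []       = []
filterB p (x ∷ xs) with p x
... | true  = x ∷ filterB p xs
... | false = filterB p xs

maxℕ : List ℕ → ℕ
maxℕ = foldr _⊔_ 0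

rankF2 : ℕ → Matrix → ℕ
rankF2 k M = maxℕ (map length (filterB (linIndep k) (subsequences M)))

corankF2 : Matrix → ℕ
corankF2 M = length M ∸ rankF2 (length M) M

-- Induced subgraph on U ⊆ V(G), U given as an (increasing) list of vertices

inducedAdj : ∀ {n} → Graph n → List (Fin n) → Matrix
inducedAdj G U = map (λ i → map (λ j → Graph.adj G i j) U) U

allSubsets : (n : ℕ) → List (List (Fin n))
allSubsets n = subsequences (allFin n)

module _ {c ℓ : Level} (R : CommutativeSemiring c ℓ) where
  open CommutativeSemiring R

  pow : Carrier → ℕ → Carrier
  pow x zero    = 1#
  pow x (suc m) = x * pow x m

  natR : ℕ → Carrier
  natR zero    = 0#
  natR (suc m) = 1# + natR m

  sumR : List Carrier → Carrier
  sumR = foldr _+_ 0#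

  sumTo : ℕ → (ℕ → Carrier) → Carrier
  sumTo m f = sumR (map f (upTo m))

  Qbar : ∀ {n} → Graph n → Carrier → Carrier → Carrier
  Qbar {n} G u v =
    sumR (map (λ U → pow u (n ∸ length U) * pow v (corankF2 (inducedAdj G U)))
              (allSubsets n))

{-# OPTIONS --safe #-}

-- Over F₂ the adjacency matrix of K_U is J − I, so the rows indexed by a nonempty S ⊆ U sum to
-- the vector whose entry in column j is |S| + [j ∈ S]. This vanishes only when |S| is odd and
-- S = U. Hence the rows are independent when |U| is even, while for odd |U| they sum to zero and
-- all but one of them are independent: the corank of K_U is |U| mod 2. Grouping the subsets of
-- V(K_n) by size then gives Q̄ = Σ_k C(n,k) u^(n−k) v^(k mod 2), split into even and odd k.

module Submission where

open import Defs
open import Level using (Level)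
open import Data.Nat using (ℕ; suc; _+_; _*_; _∸_; _≤_; _<_; z≤n; s≤s; NonZero)
open import Data.Nat.DivMod using (_/_; m≡m%n+[m/n]*n; m%n<n; m/n≤m)
open import Data.Nat.Combinatorics using (_C_; k>n⇒nCk≡0; nCk+nC[k+1]≡[n+1]C[k+1])
open import Algebra.Bundles using (CommutativeSemiring)

open import Data.Bool using (Bool; true; false; not; _∨_; _xor_; T; if_then_else_)
open import Data.Bool.Properties using (¬-not; not-injective; not-distribˡ-xor; not-involutive; xor-comm; T-≡; T-not-≡)
open import Data.Fin using (Fin; _≟_)
open import Data.List using (List; []; _∷_; map; foldr; length; replicate; _++_; allFin; applyUpTo)
open import Data.List.Properties using (length-map; length-tabulate; map-∘; map-++; map-cong-local; map-applyUpTo)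
open import Data.List.Membership.Propositional using (_∈_)
open import Data.List.Membership.Propositional.Properties using (∈-++⁺ˡ; ∈-++⁺ʳ; ∈-++⁻; ∈-map⁺; ∈-map⁻)
open import Data.List.Relation.Binary.Equality.Propositional using (≋⇒≡)
open import Data.List.Relation.Binary.Sublist.Propositional using (_⊆_; _⊇_; []; _∷_; _∷ʳ_; ⊆-refl; ⊆-trans)
open import Data.List.Relation.Binary.Sublist.Propositional.Properties using (All-resp-⊆; Any-resp-⊆; length-mono-≤; to-≋; map⁺)
import Data.List.Relation.Unary.All as All
open import Data.List.Relation.Unary.All.Properties using (all⁺; all⁻)
open import Data.List.Relation.Unary.Any using (here; there)
open import Data.List.Relation.Unary.Unique.Propositional using (Unique; _∷_)
open import Data.List.Relation.Unary.Unique.Propositional.Properties using (Unique[x∷xs]⇒x∉xs; allFin⁺)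
open import Data.Nat.Properties using (≤-antisym; ≤-trans; ≤-reflexive; ⊔-lub; m≤m⊔n; m≤n⇒m≤o⊔n; m≤n⇒m<n∨m≡n; n∸n≡0; m∸[m∸n]≡n; <-irrefl; ≤-refl; +-suc; *-suc; n≤1+n; +-monoˡ-<; *-monoˡ-≤; <-≤-trans; ≤-pred; m≤m+n)
import Data.Nat.Properties as ℕ
open import Data.Product using (∃; _×_; _,_)
open import Data.Sum using (inj₁; inj₂)
open import Function using (_∘_; Equivalence)
open import Relation.Binary.Definitions using (_Respects_)
open import Relation.Binary.PropositionalEquality using (_≡_; refl; sym; trans; cong; cong₂; subst; subst₂; module ≡-Reasoning)
open import Relation.Nullary using (yes; no; contradiction)
open import Relation.Nullary.Decidable using (⌊_⌋)

module _ {a} {A : Set a} where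

  ∈-subsequences⁺ : ∀ {ys xs : List A} → ys ⊆ xs → ys ∈ subsequences xs
  ∈-subsequences⁺ [] = here refl
  ∈-subsequences⁺ (_ ∷ʳ p) = ∈-++⁺ˡ (∈-subsequences⁺ p)
  ∈-subsequences⁺ {xs = x ∷ xs} (refl ∷ p) =
    ∈-++⁺ʳ (subsequences xs) (∈-map⁺ (x ∷_) (∈-subsequences⁺ p))

  ∈-subsequences⁻ : ∀ {ys xs : List A} → ys ∈ subsequences xs → ys ⊆ xs
  ∈-subsequences⁻ {xs = []} (here refl) = []
  ∈-subsequences⁻ {xs = x ∷ xs} m with ∈-++⁻ (subsequences xs) m
  ... | inj₁ m′ = x ∷ʳ ∈-subsequences⁻ m′
  ... | inj₂ m′ with ∈-map⁻ (x ∷_) m′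
  ...   | _ , m″ , refl = refl ∷ ∈-subsequences⁻ m″

  ⊆-map⁻ : ∀ {b} {B : Set b} (f : A → B) {ys : List B} {xs : List A} →
           ys ⊆ map f xs → ∃ λ zs → zs ⊆ xs × ys ≡ map f zs
  ⊆-map⁻ f {xs = []} [] = [] , [] , refl
  ⊆-map⁻ f {xs = x ∷ xs} (_ ∷ʳ p) with ⊆-map⁻ f p
  ... | zs , q , refl = zs , x ∷ʳ q , refl
  ⊆-map⁻ f {xs = x ∷ xs} (refl ∷ p) with ⊆-map⁻ f p
  ... | zs , q , refl = x ∷ zs , refl ∷ q , refl

  Unique-resp-⊆ : Unique {A = A} Respects _⊇_
  Unique-resp-⊆ [] u = u
  Unique-resp-⊆ (_ ∷ʳ p) (_ ∷ u) = Unique-resp-⊆ p u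
  Unique-resp-⊆ (refl ∷ p) (x≢ ∷ u) = All-resp-⊆ p x≢ ∷ Unique-resp-⊆ p u

  ⊆-covering⇒≡ : ∀ {ys xs : List A} → Unique xs → ys ⊆ xs → (∀ {x} → x ∈ xs → x ∈ ys) → ys ≡ xs
  ⊆-covering⇒≡ _ [] _ = refl
  ⊆-covering⇒≡ u (_ ∷ʳ p) covers =
    contradiction (Any-resp-⊆ p (covers (here refl))) (Unique[x∷xs]⇒x∉xs u)
  ⊆-covering⇒≡ {_ ∷ ys} {_ ∷ xs} u@(_ ∷ u′) (refl ∷ p) covers = cong (_ ∷_) (⊆-covering⇒≡ u′ p covers′)
    where
    covers′ : ∀ {z} → z ∈ xs → z ∈ ys
    covers′ m with covers (there m)
    ... | here refl = contradiction m (Unique[x∷xs]⇒x∉xs u)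
    ... | there m′ = m′

  ∈-filterB⁺ : ∀ (p : A → Bool) {x xs} → x ∈ xs → p x ≡ true → x ∈ filterB p xs
  ∈-filterB⁺ p {xs = y ∷ xs} (here refl) px with p y
  ... | true = here refl
  ∈-filterB⁺ p {xs = y ∷ xs} (there m) px with p y
  ... | true = there (∈-filterB⁺ p m px)
  ... | false = ∈-filterB⁺ p m px

  ∈-filterB⁻ : ∀ (p : A → Bool) {x xs} → x ∈ filterB p xs → x ∈ xs × p x ≡ true
  ∈-filterB⁻ p {xs = y ∷ xs} m with p y in py
  ∈-filterB⁻ p {xs = y ∷ xs} (here refl) | true = here refl , py
  ∈-filterB⁻ p {xs = y ∷ xs} (there m) | true with ∈-filterB⁻ p m
  ... | m′ , px = there m′ , px
  ∈-filterB⁻ p {xs = y ∷ xs} m | false with ∈-filterB⁻ p m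
  ... | m′ , px = there m′ , px

maxℕ-lub : ∀ {b} (xs : List ℕ) → (∀ {x} → x ∈ xs → x ≤ b) → maxℕ xs ≤ b
maxℕ-lub [] _ = z≤n
maxℕ-lub (x ∷ xs) bounded = ⊔-lub (bounded (here refl)) (maxℕ-lub xs (bounded ∘ there))

∈⇒≤maxℕ : ∀ {x xs} → x ∈ xs → x ≤ maxℕ xs
∈⇒≤maxℕ (here refl) = m≤m⊔n _ _
∈⇒≤maxℕ {xs = y ∷ _} (there m) = m≤n⇒m≤o⊔n y (∈⇒≤maxℕ m)

emptyOrNonzeroSum : ℕ → List Row → Bool
emptyOrNonzeroSum k ss = not (nonEmpty ss) ∨ not (isZeroRow (sumRows k ss))

linIndep-intro : ∀ k rs → (∀ {r ss} → r ∷ ss ⊆ rs → isZeroRow (sumRows k (r ∷ ss)) ≡ false) →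
                 linIndep k rs ≡ true
linIndep-intro k rs nonzero = Equivalence.to T-≡ (all⁻ (emptyOrNonzeroSum k) (All.tabulate (independent ∘ ∈-subsequences⁻)))
  where
  independent : ∀ {ss} → ss ⊆ rs → T (emptyOrNonzeroSum k ss)
  independent {[]} _ = _
  independent {_ ∷ _} p = Equivalence.from T-not-≡ (nonzero p)

linIndep⇒nonzero : ∀ k {r rs} → linIndep k (r ∷ rs) ≡ true → isZeroRow (sumRows k (r ∷ rs)) ≡ false
linIndep⇒nonzero k {r} {rs} li = Equivalence.to T-not-≡
  (All.lookup (all⁺ (emptyOrNonzeroSum k) (subsequences (r ∷ rs)) (Equivalence.from T-≡ li)) (∈-subsequences⁺ {ys = r ∷ rs} ⊆-refl))

rankF2-lub : ∀ {k M b} → (∀ {rs} → rs ⊆ M → linIndep k rs ≡ true → length rs ≤ b) → rankF2 k M ≤ b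
rankF2-lub {k} {M} bounded = maxℕ-lub _ bound
  where
  bound : ∀ {x} → x ∈ map length (filterB (linIndep k) (subsequences M)) → x ≤ _
  bound m with ∈-map⁻ length m
  ... | rs , rs∈ , refl with ∈-filterB⁻ (linIndep k) rs∈
  ...   | rs∈′ , li = bounded (∈-subsequences⁻ rs∈′) li

linIndep⇒≤rankF2 : ∀ {k M rs} → rs ⊆ M → linIndep k rs ≡ true → length rs ≤ rankF2 k M
linIndep⇒≤rankF2 {k} p li = ∈⇒≤maxℕ (∈-map⁺ length (∈-filterB⁺ (linIndep k) (∈-subsequences⁺ p) li))

rankF2≤length : ∀ k M → rankF2 k M ≤ length M
rankF2≤length k M = rankF2-lub {k} {M} (λ p _ → length-mono-≤ p)

dependent⇒rankF2<length : ∀ k {r rs} → isZeroRow (sumRows k (r ∷ rs)) ≡ true → rankF2 k (r ∷ rs) ≤ length rs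
dependent⇒rankF2<length k {r} {rs} zero = rankF2-lub shorter
  where
  shorter : ∀ {ss} → ss ⊆ r ∷ rs → linIndep k ss ≡ true → length ss ≤ length rs
  shorter p li with m≤n⇒m<n∨m≡n (length-mono-≤ p)
  ... | inj₁ (s≤s lt) = lt
  ... | inj₂ eq with ≋⇒≡ (to-≋ eq p)
  ...   | refl with () ← trans (sym zero) (linIndep⇒nonzero k {r} {rs} li)

odd : ℕ → Bool
odd 0 = false
odd (suc n) = not (odd n)

odd-2* : ∀ k → odd (2 * k) ≡ false
odd-2* 0 = refl
odd-2* (suc k) = trans (cong odd (*-suc 2 k)) (trans (not-involutive (odd (2 * k))) (odd-2* k))

odd-2*+1 : ∀ k → odd (2 * k + 1) ≡ true
odd-2*+1 k rewrite ℕ.+-comm (2 * k) 1 | odd-2* k = refl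

xors : List Bool → Bool
xors = foldr _xor_ false

xors-map-not : ∀ bs → xors (map not bs) ≡ odd (length bs) xor xors bs
xors-map-not [] = refl
xors-map-not (b ∷ bs) rewrite xors-map-not bs = swap b (odd (length bs)) (xors bs)
  where
  swap : ∀ b p x → not b xor (p xor x) ≡ not p xor (b xor x)
  swap false p x = not-distribˡ-xor p x
  swap true true x = refl
  swap true false x = sym (not-involutive x)

isZeroRow-map⁻ : ∀ {a} {A : Set a} (h : A → Bool) {xs x} → x ∈ xs → isZeroRow (map h xs) ≡ true → h x ≡ false
isZeroRow-map⁻ h {x ∷ _} (here refl) zero with h x
... | false = refl
isZeroRow-map⁻ h {y ∷ _} (there m) zero with h y
... | false = isZeroRow-map⁻ h m zero

isZeroRow-map⁺ : ∀ {a} {A : Set a} (h : A → Bool) {xs} → (∀ {x} → x ∈ xs → h x ≡ false) → isZeroRow (map h xs) ≡ true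
isZeroRow-map⁺ h {[]} _ = refl
isZeroRow-map⁺ h {x ∷ _} vanishes rewrite vanishes (here refl) = isZeroRow-map⁺ h (vanishes ∘ there)

sumRows-map : ∀ {a b} {A : Set a} {B : Set b} (g : A → B → Bool) (xs : List B) (ys : List A) →
              sumRows (length xs) (map (λ i → map (g i) xs) ys) ≡ map (λ j → xors (map (λ i → g i j) ys)) xs
sumRows-map g xs [] = replicate-false xs
  where
  replicate-false : ∀ xs → replicate (length xs) false ≡ map (λ _ → false) xs
  replicate-false [] = refl
  replicate-false (_ ∷ xs) = cong (false ∷_) (replicate-false xs)
sumRows-map g xs (i ∷ ys) rewrite sumRows-map g xs ys = zipWith-xor xs
  where
  zipWith-xor : ∀ xs → map (g i) xs ⊕ map (λ j → xors (map (λ i → g i j) ys)) xs ≡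
                       map (λ j → xors (map (λ i → g i j) (i ∷ ys))) xs
  zipWith-xor [] = refl
  zipWith-xor (_ ∷ xs) = cong (_ ∷_) (zipWith-xor xs)

module _ {N : ℕ} where

  rowK : List (Fin N) → Fin N → Row
  rowK U i = map (Graph.adj (completeGraph N) i) U

  _==_ : Fin N → Fin N → Bool
  i == j = ⌊ i ≟ j ⌋

  xors-==-true⇒∈ : ∀ {j : Fin N} S → xors (map (_== j) S) ≡ true → j ∈ S
  xors-==-true⇒∈ {j} (s ∷ S) hit with s ≟ j
  ... | yes refl = here refl
  ... | no _ = there (xors-==-true⇒∈ S hit)

  xors-==-∈ : ∀ {j : Fin N} {S} → Unique S → j ∈ S → xors (map (_== j) S) ≡ true
  xors-==-∈ {j} {j ∷ S} u (here refl) with j ≟ j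
  ... | yes _ = cong not (¬-not (λ hit → Unique[x∷xs]⇒x∉xs u (xors-==-true⇒∈ S hit)))
  ... | no j≢j = contradiction refl j≢j
  xors-==-∈ {j} {s ∷ S} (s∉ ∷ u) (there m) with s ≟ j
  ... | yes refl = contradiction m (Unique[x∷xs]⇒x∉xs (s∉ ∷ u))
  ... | no _ = xors-==-∈ u m

  columnSum-K : ∀ S j → xors (map (λ i → Graph.adj (completeGraph N) i j) S) ≡
                        odd (length S) xor xors (map (_== j) S)
  columnSum-K S j = begin
    xors (map (not ∘ (_== j)) S)                        ≡⟨ cong xors (map-∘ S) ⟩
    xors (map not (map (_== j) S))                      ≡⟨ xors-map-not (map (_== j) S) ⟩
    odd (length (map (_== j) S)) xor xors (map (_== j) S) ≡⟨ cong (λ n → odd n xor xors (map (_== j) S)) (length-map (_== j) S) ⟩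
    odd (length S) xor xors (map (_== j) S)             ∎
    where open ≡-Reasoning

  zeroColumns-K : ∀ {U S j} → isZeroRow (sumRows (length U) (map (rowK U) S)) ≡ true → j ∈ U →
                  odd (length S) xor xors (map (_== j) S) ≡ false
  zeroColumns-K {U} {S} {j} zero m = trans (sym (columnSum-K S j))
    (isZeroRow-map⁻ _ m (subst (λ r → isZeroRow r ≡ true) (sumRows-map (Graph.adj (completeGraph N)) U S) zero))

  zeroSum-K⇒odd∧full : ∀ {U s S} → Unique U → s ∷ S ⊆ U → isZeroRow (sumRows (length U) (map (rowK U) (s ∷ S))) ≡ true →
               odd (length (s ∷ S)) ≡ true × s ∷ S ≡ U
  zeroSum-K⇒odd∧full {U} {s} {S} u p zero = isOdd , ⊆-covering⇒≡ u p covers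
    where
    isOdd : odd (length (s ∷ S)) ≡ true
    isOdd with zeroColumns-K {U} {s ∷ S} zero (Any-resp-⊆ p (here refl))
    ... | column-s rewrite xors-==-∈ (Unique-resp-⊆ p u) (here refl) =
      not-injective (trans (xor-comm true _) column-s)
    covers : ∀ {j} → j ∈ U → j ∈ s ∷ S
    covers m with zeroColumns-K {U} {s ∷ S} zero m
    ... | column-j rewrite isOdd = xors-==-true⇒∈ (s ∷ S) (not-injective column-j)

  zeroSum-K-odd-full : ∀ {U} → Unique U → odd (length U) ≡ true →
                   isZeroRow (sumRows (length U) (map (rowK U) U)) ≡ true
  zeroSum-K-odd-full {U} u isOdd rewrite sumRows-map (Graph.adj (completeGraph N)) U U =
    isZeroRow-map⁺ _ λ {j} m → trans (columnSum-K U j) (cong₂ _xor_ isOdd (xors-==-∈ u m))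

  linIndep-K : ∀ {U S} → Unique U → S ⊆ U → (odd (length U) ≡ true → length S < length U) →
               linIndep (length U) (map (rowK U) S) ≡ true
  linIndep-K {U} {S} u S⊆U short = linIndep-intro (length U) (map (rowK U) S) nonzero
    where
    nonzero : ∀ {r rs} → r ∷ rs ⊆ map (rowK U) S → isZeroRow (sumRows (length U) (r ∷ rs)) ≡ false
    nonzero p with ⊆-map⁻ (rowK U) p
    ... | t ∷ ts , q , refl = ¬-not λ zero →
      let isOdd , t∷ts≡U = zeroSum-K⇒odd∧full u (⊆-trans q S⊆U) zero in
      <-irrefl refl (≤-trans (short (subst (λ V → odd (length V) ≡ true) t∷ts≡U isOdd))
                             (subst (_≤ length S) (cong length t∷ts≡U) (length-mono-≤ q)))

  rankF2-K-even : ∀ {U} → Unique U → odd (length U) ≡ false → rankF2 (length U) (map (rowK U) U) ≡ length U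
  rankF2-K-even {U} u isEven = ≤-antisym upper lower
    where
    upper : rankF2 (length U) (map (rowK U) U) ≤ length U
    upper = ≤-trans (rankF2≤length (length U) (map (rowK U) U)) (≤-reflexive (length-map (rowK U) U))
    lower : length U ≤ rankF2 (length U) (map (rowK U) U)
    lower = ≤-trans (≤-reflexive (sym (length-map (rowK U) U)))
      (linIndep⇒≤rankF2 {length U} {map (rowK U) U} ⊆-refl
        (linIndep-K u ⊆-refl λ isOdd → contradiction (trans (sym isOdd) isEven) λ ()))

  rankF2-K-odd : ∀ {x U} → Unique (x ∷ U) → odd (suc (length U)) ≡ true →
                 rankF2 (suc (length U)) (map (rowK (x ∷ U)) (x ∷ U)) ≡ length U
  rankF2-K-odd {x} {U} u isOdd = ≤-antisym upper lower
    where
    V = x ∷ U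
    upper : rankF2 (length V) (map (rowK V) V) ≤ length U
    upper = ≤-trans (dependent⇒rankF2<length (length V) {rowK V x} {map (rowK V) U} (zeroSum-K-odd-full u isOdd))
                    (≤-reflexive (length-map (rowK V) U))
    lower : length U ≤ rankF2 (length V) (map (rowK V) V)
    lower = ≤-trans (≤-reflexive (sym (length-map (rowK V) U)))
      (linIndep⇒≤rankF2 {length V} {map (rowK V) V} (map⁺ (rowK V) (x ∷ʳ ⊆-refl))
        (linIndep-K u (x ∷ʳ ⊆-refl) λ _ → ≤-refl))

  corankF2-rowK : ∀ U → corankF2 (map (rowK U) U) ≡ length U ∸ rankF2 (length U) (map (rowK U) U)
  corankF2-rowK U = cong (λ k → k ∸ rankF2 k (map (rowK U) U)) (length-map (rowK U) U)

  corankF2-K : ∀ U → Unique U → corankF2 (inducedAdj (completeGraph N) U) ≡ (if odd (length U) then 1 else 0)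
  corankF2-K U u with odd (length U) in parity
  ... | false = begin
    corankF2 (map (rowK U) U)                         ≡⟨ corankF2-rowK U ⟩
    length U ∸ rankF2 (length U) (map (rowK U) U)     ≡⟨ cong (length U ∸_) (rankF2-K-even u parity) ⟩
    length U ∸ length U                               ≡⟨ n∸n≡0 (length U) ⟩
    0                                                 ∎
    where open ≡-Reasoning
  corankF2-K (x ∷ U) u | true = begin
    corankF2 (map (rowK (x ∷ U)) (x ∷ U))                     ≡⟨ corankF2-rowK (x ∷ U) ⟩
    suc (length U) ∸ rankF2 (suc (length U)) (map (rowK (x ∷ U)) (x ∷ U)) ≡⟨ cong (suc (length U) ∸_) (rankF2-K-odd u parity) ⟩
    suc (length U) ∸ length U                                 ≡⟨ m∸[m∸n]≡n {suc (length U)} (s≤s z≤n) ⟩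
    1                                                         ∎
    where open ≡-Reasoning

m<[1+m/n]*n : ∀ m n .{{_ : NonZero n}} → m < suc (m / n) * n
m<[1+m/n]*n m n = subst (_< suc (m / n) * n) (sym (m≡m%n+[m/n]*n m n)) (+-monoˡ-< (m / n * n) (m%n<n m n))

n/2+1≤k⇒n<2k : ∀ {n k} → n / 2 + 1 ≤ k → n < 2 * k
n/2+1≤k⇒n<2k {n} {k} le = <-≤-trans (m<[1+m/n]*n n 2)
  (≤-trans (*-monoˡ-≤ 2 (subst (_≤ k) (ℕ.+-comm (n / 2) 1) le)) (≤-reflexive (ℕ.*-comm k 2)))

[n+1]/2≤k⇒n<2k+1 : ∀ {n k} → (n + 1) / 2 ≤ k → n < 2 * k + 1
[n+1]/2≤k⇒n<2k+1 {n} {k} le = subst₂ _≤_ (ℕ.+-comm n 1) (trans (cong suc (ℕ.*-comm k 2)) (ℕ.+-comm 1 (2 * k)))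
  (≤-pred (<-≤-trans (m<[1+m/n]*n (n + 1) 2) (*-monoˡ-≤ 2 (s≤s le))))

n/2+1≤1+n : ∀ n → n / 2 + 1 ≤ suc n
n/2+1≤1+n n = subst (_≤ suc n) (ℕ.+-comm 1 (n / 2)) (s≤s (m/n≤m n 2))

[n+1]/2≤1+n : ∀ n → (n + 1) / 2 ≤ suc n
[n+1]/2≤1+n n = subst ((n + 1) / 2 ≤_) (ℕ.+-comm n 1) (m/n≤m (n + 1) 2)

module _ {c ℓ} (R : CommutativeSemiring c ℓ) where
  open CommutativeSemiring R
    renaming (_+_ to _+ᴿ_; _*_ to _*ᴿ_; refl to ≈-refl; sym to ≈-sym; trans to ≈-trans)
  open import Algebra.Properties.CommutativeSemigroup +-commutativeSemigroup using (interchange; x∙yz≈y∙xz)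
  open import Relation.Binary.Reasoning.Setoid setoid

  -- Unlike sumTo, this unfolds definitionally: sumUpTo (suc m) f = f 0 + sumUpTo m (f ∘ suc).
  sumUpTo : ℕ → (ℕ → Carrier) → Carrier
  sumUpTo m f = sumR R (applyUpTo f m)

  sumTo≡sumUpTo : ∀ m f → sumTo R m f ≡ sumUpTo m f
  sumTo≡sumUpTo m f = cong (sumR R) (map-applyUpTo (λ k → k) f m)

  sumUpTo-cong : ∀ m {f g : ℕ → Carrier} → (∀ k → f k ≈ g k) → sumUpTo m f ≈ sumUpTo m g
  sumUpTo-cong 0 _ = ≈-refl
  sumUpTo-cong (suc m) f≈g = +-cong (f≈g 0) (sumUpTo-cong m (f≈g ∘ suc))

  sumUpTo-+ : ∀ m (f g : ℕ → Carrier) → sumUpTo m (λ k → f k +ᴿ g k) ≈ sumUpTo m f +ᴿ sumUpTo m g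
  sumUpTo-+ 0 f g = ≈-sym (+-identityˡ 0#)
  sumUpTo-+ (suc m) f g = ≈-trans (+-cong ≈-refl (sumUpTo-+ m (f ∘ suc) (g ∘ suc))) (interchange (f 0) (g 0) _ _)

  sumUpTo-*ˡ : ∀ m a (f : ℕ → Carrier) → sumUpTo m (λ k → a *ᴿ f k) ≈ a *ᴿ sumUpTo m f
  sumUpTo-*ˡ 0 a f = ≈-sym (zeroʳ a)
  sumUpTo-*ˡ (suc m) a f = ≈-trans (+-cong ≈-refl (sumUpTo-*ˡ m a (f ∘ suc))) (≈-sym (distribˡ a _ _))

  sumUpTo-zero : ∀ m (f : ℕ → Carrier) → (∀ k → f k ≈ 0#) → sumUpTo m f ≈ 0#
  sumUpTo-zero 0 f _ = ≈-refl
  sumUpTo-zero (suc m) f vanishes =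
    ≈-trans (+-cong (vanishes 0) (sumUpTo-zero m (f ∘ suc) (vanishes ∘ suc))) (+-identityˡ 0#)

  sumUpTo-truncate : ∀ {a b} (f : ℕ → Carrier) → a ≤ b → (∀ k → a ≤ k → f k ≈ 0#) → sumUpTo b f ≈ sumUpTo a f
  sumUpTo-truncate {0} {b} f _ vanishes = sumUpTo-zero b f (λ k → vanishes k z≤n)
  sumUpTo-truncate {suc a} {suc b} f (s≤s a≤b) vanishes =
    +-cong ≈-refl (sumUpTo-truncate (f ∘ suc) a≤b (λ k a≤k → vanishes (suc k) (s≤s a≤k)))

  sumUpTo-even+odd : ∀ m (f : ℕ → Carrier) →
                     sumUpTo (m + m) f ≈ sumUpTo m (λ k → f (2 * k)) +ᴿ sumUpTo m (λ k → f (2 * k + 1))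
  sumUpTo-even+odd 0 f = ≈-sym (+-identityˡ 0#)
  sumUpTo-even+odd (suc m) f rewrite +-suc m m = begin
    f 0 +ᴿ (f 1 +ᴿ sumUpTo (m + m) f″)                                ≈⟨ +-cong ≈-refl (+-cong ≈-refl (sumUpTo-even+odd m f″)) ⟩
    f 0 +ᴿ (f 1 +ᴿ (evens +ᴿ odds))                                    ≈⟨ +-cong ≈-refl (x∙yz≈y∙xz (f 1) evens odds) ⟩
    f 0 +ᴿ (evens +ᴿ (f 1 +ᴿ odds))                                    ≈⟨ +-assoc (f 0) evens _ ⟨
    (f 0 +ᴿ evens) +ᴿ (f 1 +ᴿ odds)                                    ≈⟨ +-cong (+-cong ≈-refl (sumUpTo-cong m (λ k → reflexive (cong f (*-suc 2 k)))))
                                                                                   (+-cong ≈-refl (sumUpTo-cong m (λ k → reflexive (cong (λ i → f (i + 1)) (*-suc 2 k))))) ⟨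
    sumUpTo (suc m) (λ k → f (2 * k)) +ᴿ sumUpTo (suc m) (λ k → f (2 * k + 1)) ∎
    where
    f″ = f ∘ suc ∘ suc
    evens = sumUpTo m (λ k → f″ (2 * k))
    odds = sumUpTo m (λ k → f″ (2 * k + 1))

  sumR-++ : ∀ xs ys → sumR R (xs ++ ys) ≈ sumR R xs +ᴿ sumR R ys
  sumR-++ [] ys = ≈-sym (+-identityˡ _)
  sumR-++ (x ∷ xs) ys = ≈-trans (+-cong ≈-refl (sumR-++ xs ys)) (≈-sym (+-assoc x _ _))

  natR-+ : ∀ a b → natR R (a + b) ≈ natR R a +ᴿ natR R b
  natR-+ 0 b = ≈-sym (+-identityˡ _)
  natR-+ (suc a) b = ≈-trans (+-cong ≈-refl (natR-+ a b)) (≈-sym (+-assoc 1# _ _))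

  binomial-term-vanishes : ∀ {n k} (x : Carrier) → n < k → natR R (n C k) *ᴿ x ≈ 0#
  binomial-term-vanishes {n} {k} x n<k rewrite k>n⇒nCk≡0 {n} {k} n<k = zeroˡ x

  sumR-subsequences : ∀ {a} {A : Set a} (F : ℕ → Carrier) (xs : List A) {m} → length xs < m →
    sumR R (map (F ∘ length) (subsequences xs)) ≈ sumUpTo m (λ k → natR R (length xs C k) *ᴿ F k)
  sumR-subsequences F [] {suc m} _ = begin
    F 0 +ᴿ 0#                                        ≈⟨ +-cong (*-identityˡ (F 0)) ≈-refl ⟨
    1# *ᴿ F 0 +ᴿ 0#                                  ≈⟨ +-cong (*-congʳ (+-identityʳ 1#)) (sumUpTo-zero m _ λ k → binomial-term-vanishes {0} {suc k} (F (suc k)) (s≤s z≤n)) ⟨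
    sumUpTo (suc m) (λ k → natR R (0 C k) *ᴿ F k)   ∎
  sumR-subsequences F (x ∷ xs) {suc m} (s≤s n<m) = begin
    sumR R (map G (A ++ map (x ∷_) A))                          ≡⟨ cong (sumR R) (map-++ G A (map (x ∷_) A)) ⟩
    sumR R (map G A ++ map G (map (x ∷_) A))                    ≈⟨ sumR-++ (map G A) _ ⟩
    sumR R (map G A) +ᴿ sumR R (map G (map (x ∷_) A))           ≡⟨ cong (λ l → sumR R (map G A) +ᴿ sumR R l) (map-∘ A) ⟨
    sumR R (map G A) +ᴿ sumR R (map (F ∘ suc ∘ length) A)       ≈⟨ +-cong (sumR-subsequences F xs (≤-trans n<m (n≤1+n m)))
                                                                         (sumR-subsequences (F ∘ suc) xs n<m) ⟩
    (head +ᴿ shifted) +ᴿ lower                                  ≈⟨ +-assoc head shifted lower ⟩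
    head +ᴿ (shifted +ᴿ lower)                                  ≈⟨ +-cong ≈-refl (+-comm shifted lower) ⟩
    head +ᴿ (lower +ᴿ shifted)                                  ≈⟨ +-cong ≈-refl (sumUpTo-+ m _ _) ⟨
    head +ᴿ sumUpTo m (λ k → natR R (n C k) *ᴿ F (suc k) +ᴿ natR R (n C suc k) *ᴿ F (suc k))
                                                                ≈⟨ +-cong ≈-refl (sumUpTo-cong m pascal) ⟩
    head +ᴿ sumUpTo m (λ k → natR R (suc n C suc k) *ᴿ F (suc k)) ∎
    where
    n = length xs
    A = subsequences xs
    G = F ∘ length
    head = natR R (n C 0) *ᴿ F 0
    shifted = sumUpTo m (λ k → natR R (n C suc k) *ᴿ F (suc k))
    lower = sumUpTo m (λ k → natR R (n C k) *ᴿ F (suc k))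
    pascal : ∀ k → natR R (n C k) *ᴿ F (suc k) +ᴿ natR R (n C suc k) *ᴿ F (suc k) ≈ natR R (suc n C suc k) *ᴿ F (suc k)
    pascal k = ≈-trans (≈-sym (distribʳ (F (suc k)) _ _))
      (*-congʳ (≈-trans (≈-sym (natR-+ (n C k) (n C suc k))) (reflexive (cong (natR R) (nCk+nC[k+1]≡[n+1]C[k+1] n k)))))

  binomial-even+odd : ∀ n (g : ℕ → Carrier) →
    sumUpTo (suc n + suc n) (λ k → natR R (n C k) *ᴿ g k) ≈
    sumUpTo (n / 2 + 1) (λ k → natR R (n C (2 * k)) *ᴿ g (2 * k)) +ᴿ
    sumUpTo ((n + 1) / 2) (λ k → natR R (n C (2 * k + 1)) *ᴿ g (2 * k + 1))
  binomial-even+odd n g = ≈-trans (sumUpTo-even+odd (suc n) (λ k → natR R (n C k) *ᴿ g k)) (+-cong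
    (sumUpTo-truncate (λ k → natR R (n C (2 * k)) *ᴿ g (2 * k)) (n/2+1≤1+n n)
      λ k k≥ → binomial-term-vanishes (g (2 * k)) (n/2+1≤k⇒n<2k k≥))
    (sumUpTo-truncate (λ k → natR R (n C (2 * k + 1)) *ᴿ g (2 * k + 1)) ([n+1]/2≤1+n n)
      λ k k≥ → binomial-term-vanishes (g (2 * k + 1)) ([n+1]/2≤k⇒n<2k+1 k≥)))

  Qbar-completeGraph : ∀ n u v → Qbar R (completeGraph n) u v ≈
    sumUpTo (suc n + suc n) (λ k → natR R (n C k) *ᴿ (pow R u (n ∸ k) *ᴿ pow R v (if odd k then 1 else 0)))
  Qbar-completeGraph n u v = begin
    Qbar R (completeGraph n) u v                                      ≡⟨ cong (sumR R) (map-cong-local (All.tabulate corank)) ⟩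
    sumR R (map (F ∘ length) (subsequences (allFin n)))               ≈⟨ sumR-subsequences F (allFin n) bound ⟩
    sumUpTo (suc n + suc n) (λ k → natR R (length (allFin n) C k) *ᴿ F k)
                                                                      ≡⟨ cong (λ l → sumUpTo (suc n + suc n) (λ k → natR R (l C k) *ᴿ F k)) length-allFin ⟩
    sumUpTo (suc n + suc n) (λ k → natR R (n C k) *ᴿ F k)           ∎
    where
    F : ℕ → Carrier
    F k = pow R u (n ∸ k) *ᴿ pow R v (if odd k then 1 else 0)
    corank : ∀ {U} → U ∈ subsequences (allFin n) →
             pow R u (n ∸ length U) *ᴿ pow R v (corankF2 (inducedAdj (completeGraph n) U)) ≡ F (length U)
    corank {U} U∈ = cong (λ r → pow R u (n ∸ length U) *ᴿ pow R v r)
      (corankF2-K U (Unique-resp-⊆ (∈-subsequences⁻ U∈) (allFin⁺ n)))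
    length-allFin : length (allFin n) ≡ n
    length-allFin = length-tabulate (λ i → i)
    bound : length (allFin n) < suc n + suc n
    bound = subst (_< suc n + suc n) (sym length-allFin) (m≤m+n (suc n) (suc n))

mainTheorem7 : ∀ {c ℓ : Level} (R : CommutativeSemiring c ℓ) (n : ℕ) (u v : CommutativeSemiring.Carrier R) →
    CommutativeSemiring._≈_ R (Qbar R (completeGraph n) u v)
      (CommutativeSemiring._+_ R
        (sumTo R (n / 2 + 1) (λ k → CommutativeSemiring._*_ R (natR R (n C (2 * k))) (pow R u (n ∸ 2 * k))))
        (CommutativeSemiring._*_ R v
          (sumTo R ((n + 1) / 2) (λ k → CommutativeSemiring._*_ R (natR R (n C (2 * k + 1))) (pow R u (n ∸ (2 * k + 1)))))))
mainTheorem7 R n u v = begin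
  Qbar R (completeGraph n) u v                                  ≈⟨ Qbar-completeGraph R n u v ⟩
  sumUpTo R (suc n + suc n) (λ k → natR R (n C k) *ᴿ g k)     ≈⟨ binomial-even+odd R n g ⟩
  sumUpTo R (n / 2 + 1) (λ k → natR R (n C (2 * k)) *ᴿ g (2 * k)) +ᴿ
    sumUpTo R ((n + 1) / 2) (λ k → natR R (n C (2 * k + 1)) *ᴿ g (2 * k + 1))
                                                                ≈⟨ +-cong (sumUpTo-cong R (n / 2 + 1) even-term)
                                                                          (≈-trans (sumUpTo-cong R ((n + 1) / 2) odd-term)
                                                                                   (sumUpTo-*ˡ R ((n + 1) / 2) v odds)) ⟩
  sumUpTo R (n / 2 + 1) evens +ᴿ v *ᴿ sumUpTo R ((n + 1) / 2) odds
                                                                ≡⟨ cong₂ (λ e o → e +ᴿ v *ᴿ o) (sumTo≡sumUpTo R (n / 2 + 1) evens) (sumTo≡sumUpTo R ((n + 1) / 2) odds) ⟨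
  sumTo R (n / 2 + 1) evens +ᴿ v *ᴿ sumTo R ((n + 1) / 2) odds ∎
  where
  open CommutativeSemiring R renaming (_+_ to _+ᴿ_; _*_ to _*ᴿ_; trans to ≈-trans)
  open import Relation.Binary.Reasoning.Setoid setoid
  open import Algebra.Properties.CommutativeSemigroup *-commutativeSemigroup using (x∙yz≈y∙xz)
  g : ℕ → Carrier
  g k = pow R u (n ∸ k) *ᴿ pow R v (if odd k then 1 else 0)
  evens odds : ℕ → Carrier
  evens k = natR R (n C (2 * k)) *ᴿ pow R u (n ∸ 2 * k)
  odds k = natR R (n C (2 * k + 1)) *ᴿ pow R u (n ∸ (2 * k + 1))
  even-term : ∀ k → natR R (n C (2 * k)) *ᴿ g (2 * k) ≈ evens k
  even-term k rewrite odd-2* k = *-congˡ (*-identityʳ _)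
  odd-term : ∀ k → natR R (n C (2 * k + 1)) *ᴿ g (2 * k + 1) ≈ v *ᴿ odds k
  odd-term k rewrite odd-2*+1 k =
    ≈-trans (*-congˡ (≈-trans (*-congˡ (*-identityʳ v)) (*-comm _ v))) (x∙yz≈y∙xz _ v _)
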